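{- Let $(T_n)_{n\in\mathbb{N}}$ be an $\mathbb{N}$-indexed family of uniformly continuously searchable closeness spaces, with closeness functions $c_n : T_n \to T_n \to \mathbb{N}_\infty$. Then the product type $\prod_{n\in\mathbb{N}} T_n$, equipped with the countable product closeness function $c_{\Pi T}$, is a uniformly continuously searchable closeness space.
   Context: We work in constructive Martin-Löf type theory with function extensionality and propositional extensionality assumed; "there is" means an explicit witness is constructed. $\mathbb{N}_\infty$ is the type of decreasing binary sequences $u:\mathbb{N}\to\{0,1\}$ (with $u_i\ge u_{i+1}$ for all $i$). For $n\in\mathbb{N}$, $\underline{n}\in\mathbb{N}_\infty$ is the sequence of $n$ ones followed by zeros, and $\infty$ is the constant sequence $1$. Write $u\preceq v$ iff for all $n$, $u_n=1$ implies $v_n=1$, and $\min(u,v)$ for the pointwise minimum. A closeness space is a type $X$ with $c:X\to X\to\mathbb{N}_\infty$ such that (i) $c(x,y)=\infty$ iff $x=y$, (ii) $c(x,y)=c(y,x)$, (iii) $\min(c(x,y),c(y,z))\preceq c(x,z)$. For $\varepsilon\in\mathbb{N}$, $x,y$ are $\varepsilon$-close, written $C_\varepsilon(x,y)$, iff $\underline{\varepsilon}\preceq c(x,y)$. A predicate $p$ on $X$ (proposition-valued) is decidable if for every $x$ we can decide $p(x)$ or $\neg p(x)$; it is uniformly continuous if there is $\delta\in\mathbb{N}$ (its modulus) such that $C_\delta(x_1,x_2)$ implies $p(x_1)\Leftrightarrow p(x_2)$. A closeness space $K$ is uniformly continuously searchable if for every decidable predicate $p$ on $K$ given together with a modulus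 of uniform continuity, there is $k_0\in K$ such that if some $k\in K$ satisfies $p(k)$ then $p(k_0)$. The countable product closeness function on $\prod_n T_n$ is defined recursively by $c_{\Pi T}(\alpha,\beta)_0 := c_0(\alpha_0,\beta_0)_0$ and $c_{\Pi T}(\alpha,\beta)_{m+1} := \min\big(c_0(\alpha_0,\beta_0)_{m+1},\ c_{\Pi(\mathrm{tail}\,T)}(\mathrm{tail}\,\alpha,\mathrm{tail}\,\beta)_m\big)$, where $\mathrm{tail}\,T = (T_{n+1})_n$ with closeness functions $(c_{n+1})_n$ and $\mathrm{tail}\,\alpha = (\alpha_{n+1})_n$ (equivalently $c_{\Pi T}(\alpha,\beta)_m=\min_{i\le m} c_i(\alpha_i,\beta_i)_{m-i}$). -}

module Defs where

open import Level using (Level; _⊔_) renaming (suc to lsuc)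
open import Data.Nat using (ℕ; zero; suc; _<ᵇ_)
open import Data.Bool using (Bool; true; false; _∧_)
open import Data.Product using (Σ; _×_; _,_; proj₁; proj₂)
open import Relation.Nullary using (Dec)
open import Relation.Binary.PropositionalEquality using (_≡_; refl)

-- ℕ∞ : decreasing binary sequences (true = 1, false = 0)
decreasing : (ℕ → Bool) → Set
decreasing u = (i : ℕ) → u (suc i) ≡ true → u i ≡ true

ℕ∞ : Set
ℕ∞ = Σ (ℕ → Bool) decreasing

ι : ℕ∞ → ℕ → Bool
ι = proj₁

private
  <ᵇ-dec : (n i : ℕ) → (suc i <ᵇ n) ≡ true → (i <ᵇ n) ≡ true
  <ᵇ-dec zero i ()
  <ᵇ-dec (suc zero) i ()
  <ᵇ-dec (suc (suc n)) zero _ = refl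
  <ᵇ-dec (suc (suc n)) (suc i) p = <ᵇ-dec (suc n) i p

under : ℕ → ℕ∞
under n = (λ i → i <ᵇ n) , <ᵇ-dec n

∞ : ℕ∞
∞ = (λ _ → true) , (λ _ _ → refl)

_≼_ : ℕ∞ → ℕ∞ → Set
u ≼ v = (n : ℕ) → ι u n ≡ true → ι v n ≡ true

private
  ∧-l : (a b : Bool) → (a ∧ b) ≡ true → a ≡ true
  ∧-l true b _ = refl
  ∧-l false b ()
  ∧-r : (a b : Bool) → (a ∧ b) ≡ true → b ≡ true
  ∧-r true b p = p
  ∧-r false b ()
  ∧-i : (a b : Bool) → a ≡ true → b ≡ true → (a ∧ b) ≡ true
  ∧-i true true _ _ = refl

min : ℕ∞ → ℕ∞ → ℕ∞
min u v = (λ i → ι u i ∧ ι v i)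
        , (λ i p → ∧-i _ _ (proj₂ u i (∧-l _ _ p)) (proj₂ v i (∧-r _ _ p)))

IsClosenessSpace : {𝓤 : Level} (X : Set 𝓤) → (X → X → ℕ∞) → Set 𝓤
IsClosenessSpace X c =
    ((x y : X) → c x y ≡ ∞ → x ≡ y)
  × ((x y : X) → x ≡ y → c x y ≡ ∞)
  × ((x y : X) → c x y ≡ c y x)
  × ((x y z : X) → min (c x y) (c y z) ≼ c x z)

C : {𝓤 : Level} {X : Set 𝓤} → (X → X → ℕ∞) → ℕ → X → X → Set
C c ε x y = under ε ≼ c x y

isProp : {𝓥 : Level} → Set 𝓥 → Set 𝓥
isProp P = (a b : P) → a ≡ b

UCSearchable : {𝓤 : Level} (𝓥 : Level) (K : Set 𝓤) → (K → K → ℕ∞) → Set (𝓤 ⊔ lsuc 𝓥)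
UCSearchable 𝓥 K c =
  (p : K → Set 𝓥) → ((k : K) → isProp (p k)) → ((k : K) → Dec (p k))
  → (δ : ℕ) → ((k₁ k₂ : K) → C c δ k₁ k₂ → (p k₁ → p k₂) × (p k₂ → p k₁))
  → Σ K (λ k₀ → Σ K p → p k₀)

Π : {𝓤 : Level} → (ℕ → Set 𝓤) → Set 𝓤
Π T = (n : ℕ) → T n

prodSeq : {𝓤 : Level} (T : ℕ → Set 𝓤) (c : (n : ℕ) → T n → T n → ℕ∞)
        → Π T → Π T → ℕ → Bool
prodSeq T c α β zero = ι (c 0 (α 0) (β 0)) 0
prodSeq T c α β (suc m) =
  ι (c 0 (α 0) (β 0)) (suc m) ∧ prodSeq (λ n → T (suc n)) (λ n → c (suc n)) (λ n → α (suc n)) (λ n → β (suc n)) m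

prodSeq-dec : {𝓤 : Level} (T : ℕ → Set 𝓤) (c : (n : ℕ) → T n → T n → ℕ∞)
            → (α β : Π T) → decreasing (prodSeq T c α β)
prodSeq-dec T c α β zero p = proj₂ (c 0 (α 0) (β 0)) 0 (∧-l _ _ p)
prodSeq-dec T c α β (suc m) p =
  ∧-i _ _ (proj₂ (c 0 (α 0) (β 0)) (suc m) (∧-l (ι (c 0 (α 0) (β 0)) (suc (suc m))) _ p))
          (prodSeq-dec (λ n → T (suc n)) (λ n → c (suc n)) (λ n → α (suc n)) (λ n → β (suc n)) m (∧-r (ι (c 0 (α 0) (β 0)) (suc (suc m))) _ p))

cΠ : {𝓤 : Level} (T : ℕ → Set 𝓤) (c : (n : ℕ) → T n → T n → ℕ∞)
   → Π T → Π T → ℕ∞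
cΠ T c α β = prodSeq T c α β , prodSeq-dec T c α β

-- The closeness on the product is the conjunction of the coordinate closenesses along the
-- diagonals, so the closeness-space axioms transfer coordinatewise. For searchability we
-- induct on the modulus δ: every predicate with modulus 0 is constant, and for a predicate p
-- with modulus δ + 1 each head x yields a predicate p (x ∷ -) of modulus δ on the tail, which
-- the induction hypothesis searches, giving a best tail β x. The head predicate
-- x ↦ p (x ∷ β x) has modulus δ + 1, because (δ + 1)-close heads give the same tail
-- predicate and hence the same β; searching it in T 0 gives the head of the witness.
module Submission where

open import Defs
open import Level using (Level; _⊔_; Lift; lift; lower) renaming (suc to lsuc)
open import Data.Nat using (ℕ; zero; suc; _+_)
open import Data.Bool using (Bool; true; _∧_; T; T?)
open import Data.Bool.Properties using (T-irrelevant) renaming (_≟_ to _≟ᵇ_)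
open import Data.Unit using (⊤)
open import Data.Product using (Σ; _×_; _,_; proj₁; proj₂)
open import Function using (id; _⇔_; mk⇔)
open import Relation.Nullary using (Dec; yes)
open import Relation.Nullary.Decidable
  using (isYes; True; isYes≗does; does-⇔; toWitness; fromWitness; map′)
open import Relation.Binary.PropositionalEquality
open import Axiom.Extensionality.Propositional using (Extensionality)
open import Axiom.UniquenessOfIdentityProofs using (module Decidable⇒UIP)

private
  variable
    𝓤 𝓥 : Level

∧-elimˡ : (a b : Bool) → a ∧ b ≡ true → a ≡ true
∧-elimˡ true  b _ = refl

∧-elimʳ : (a b : Bool) → a ∧ b ≡ true → b ≡ true
∧-elimʳ true  b p = p

∧-intro : {a b : Bool} → a ≡ true → b ≡ true → a ∧ b ≡ true
∧-intro refl refl = refl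

isYes-⇔ : {A B : Set 𝓤} → A ⇔ B → (a? : Dec A) (b? : Dec B) → isYes a? ≡ isYes b?
isYes-⇔ A⇔B a? b? =
  trans (isYes≗does a?) (trans (does-⇔ A⇔B a? b?) (sym (isYes≗does b?)))

≡ᵇ-irrelevant : {a b : Bool} (p q : a ≡ b) → p ≡ q
≡ᵇ-irrelevant = Decidable⇒UIP.≡-irrelevant _≟ᵇ_

≡∞⇒≼ : (u : ℕ∞) {v : ℕ∞} → v ≡ ∞ → u ≼ v
≡∞⇒≼ u refl _ _ = refl

C-zero : {X : Set 𝓤} (c : X → X → ℕ∞) (x y : X) → C c 0 x y
C-zero c x y n ()

closeness-reflexive : {X : Set 𝓤} {c : X → X → ℕ∞} → IsClosenessSpace X c → ∀ x → c x x ≡ ∞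
closeness-reflexive (_ , ≡⇒∞ , _) x = ≡⇒∞ x x refl

UniformlyContinuous : {K : Set 𝓤} → (K → K → ℕ∞) → ℕ → (K → Set 𝓥) → Set (𝓤 ⊔ 𝓥)
UniformlyContinuous c δ p =
  (k₁ k₂ : _) → C c δ k₁ k₂ → (p k₁ → p k₂) × (p k₂ → p k₁)

UCSearchableWithModulus : (𝓥 : Level) (K : Set 𝓤) → (K → K → ℕ∞) → ℕ → Set (𝓤 ⊔ lsuc 𝓥)
UCSearchableWithModulus 𝓥 K c δ =
  (p : K → Set 𝓥) → ((k : K) → isProp (p k)) → ((k : K) → Dec (p k))
  → UniformlyContinuous c δ p → Σ K (λ k₀ → Σ K p → p k₀)

UCSearchable⇒inhabited : {K : Set 𝓤} {c : K → K → ℕ∞} → UCSearchable 𝓥 K c → K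
UCSearchable⇒inhabited S =
  proj₁ (S (λ _ → Lift _ ⊤) (λ _ _ _ → refl) (λ _ → yes _) 0 (λ _ _ _ → id , id))

ContinuousBool : {K : Set 𝓤} → (K → K → ℕ∞) → ℕ → (K → Bool) → Set 𝓤
ContinuousBool c δ f = (k₁ k₂ : _) → C c δ k₁ k₂ → f k₁ ≡ f k₂

searchᵇ : {K : Set 𝓤} {c : K → K → ℕ∞} {δ : ℕ} → UCSearchableWithModulus 𝓥 K c δ
        → (f : K → Bool) → ContinuousBool c δ f
        → Σ K (λ k₀ → Σ K (λ k → T (f k)) → T (f k₀))
searchᵇ {𝓥 = 𝓥} {K = K} S f f-cont =
  proj₁ found , λ (k , fk) → lower (proj₂ found (k , lift fk))
  where
    Holds : K → Set 𝓥
    Holds k = Lift 𝓥 (T (f k))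
    transport : {b b′ : Bool} → b ≡ b′ → Lift 𝓥 (T b) → Lift 𝓥 (T b′)
    transport = subst (λ b → Lift 𝓥 (T b))
    found : Σ K (λ k₀ → Σ K Holds → Holds k₀)
    found = S Holds (λ k a b → cong lift (T-irrelevant (lower a) (lower b)))
              (λ k → map′ lift lower (T? (f k)))
              (λ k₁ k₂ h → transport (f-cont k₁ k₂ h) , transport (sym (f-cont k₁ k₂ h)))

module _ {𝓤 : Level} where

  _∷_ : {T : ℕ → Set 𝓤} → T 0 → Π (λ n → T (suc n)) → Π T
  (x ∷ β) zero    = x
  (x ∷ β) (suc n) = β n

  tail : {T : ℕ → Set 𝓤} → Π T → Π (λ n → T (suc n))
  tail α n = α (suc n)

  prodSeq-coordinate : (T : ℕ → Set 𝓤) (c : (n : ℕ) → T n → T n → ℕ∞) (α β : Π T) (i k : ℕ)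
    → prodSeq T c α β (i + k) ≡ true → ι (c i (α i) (β i)) k ≡ true
  prodSeq-coordinate T c α β zero zero    p = p
  prodSeq-coordinate T c α β zero (suc k) p = ∧-elimˡ _ _ p
  prodSeq-coordinate T c α β (suc i) k    p =
    prodSeq-coordinate _ (λ n → c (suc n)) (tail α) (tail β) i k (∧-elimʳ _ _ p)

  prodSeq-refl : (T : ℕ → Set 𝓤) (c : (n : ℕ) → T n → T n → ℕ∞)
    → (∀ n x → c n x x ≡ ∞) → (α : Π T) (m : ℕ) → prodSeq T c α α m ≡ true
  prodSeq-refl T c c-refl α zero    = cong (λ u → ι u 0) (c-refl 0 (α 0))
  prodSeq-refl T c c-refl α (suc m) =
    ∧-intro (cong (λ u → ι u (suc m)) (c-refl 0 (α 0)))
            (prodSeq-refl _ (λ n → c (suc n)) (λ n → c-refl (suc n)) (tail α) m)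

  prodSeq-sym : (T : ℕ → Set 𝓤) (c : (n : ℕ) → T n → T n → ℕ∞)
    → (∀ n x y → c n x y ≡ c n y x) → (α β : Π T) (m : ℕ)
    → prodSeq T c α β m ≡ prodSeq T c β α m
  prodSeq-sym T c c-sym α β zero    = cong (λ u → ι u 0) (c-sym 0 (α 0) (β 0))
  prodSeq-sym T c c-sym α β (suc m) =
    cong₂ _∧_ (cong (λ u → ι u (suc m)) (c-sym 0 (α 0) (β 0)))
              (prodSeq-sym _ (λ n → c (suc n)) (λ n → c-sym (suc n)) (tail α) (tail β) m)

  cΠ-ultra : (T : ℕ → Set 𝓤) (c : (n : ℕ) → T n → T n → ℕ∞)
    → (∀ n x y z → min (c n x y) (c n y z) ≼ c n x z) → (α β γ : Π T)
    → min (cΠ T c α β) (cΠ T c β γ) ≼ cΠ T c α γ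
  cΠ-ultra T c c-ultra α β γ zero p = c-ultra 0 (α 0) (β 0) (γ 0) 0 p
  cΠ-ultra T c c-ultra α β γ (suc m) p =
    ∧-intro (c-ultra 0 (α 0) (β 0) (γ 0) (suc m) (∧-intro (∧-elimˡ a P αβ) (∧-elimˡ b Q βγ)))
            (cΠ-ultra _ (λ n → c (suc n)) (λ n → c-ultra (suc n)) (tail α) (tail β) (tail γ)
              m (∧-intro (∧-elimʳ a P αβ) (∧-elimʳ b Q βγ)))
    where
      a b P Q : Bool
      a = ι (c 0 (α 0) (β 0)) (suc m)
      b = ι (c 0 (β 0) (γ 0)) (suc m)
      P = prodSeq _ (λ n → c (suc n)) (tail α) (tail β) m
      Q = prodSeq _ (λ n → c (suc n)) (tail β) (tail γ) m
      αβ : a ∧ P ≡ true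
      αβ = ∧-elimˡ (a ∧ P) (b ∧ Q) p
      βγ : b ∧ Q ≡ true
      βγ = ∧-elimʳ (a ∧ P) (b ∧ Q) p

  ∷-close : {T : ℕ → Set 𝓤} {c : (n : ℕ) → T n → T n → ℕ∞} {d : ℕ}
    {x x′ : T 0} {β β′ : Π (λ n → T (suc n))}
    → C (c 0) (suc d) x x′ → C (cΠ _ (λ n → c (suc n))) d β β′
    → C (cΠ T c) (suc d) (x ∷ β) (x′ ∷ β′)
  ∷-close x≈x′ β≈β′ zero    q = x≈x′ zero q
  ∷-close x≈x′ β≈β′ (suc n) q = ∧-intro (x≈x′ (suc n) q) (β≈β′ n q)

module _ (funext : ∀ {a b} → Extensionality a b) where

  ℕ∞-ext : (u v : ℕ∞) → (∀ i → ι u i ≡ ι v i) → u ≡ v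
  ℕ∞-ext (f , _) (g , _) f≗g with refl ← funext f≗g =
    cong (f ,_) (funext λ i → funext λ _ → ≡ᵇ-irrelevant _ _)

  ∷-η : {T : ℕ → Set 𝓤} (α : Π T) → α 0 ∷ tail α ≡ α
  ∷-η α = funext λ { zero → refl ; (suc n) → refl }

  ContinuousBool-isProp : {K : Set 𝓤} (c : K → K → ℕ∞) (δ : ℕ) (f : K → Bool)
    → isProp (ContinuousBool c δ f)
  ContinuousBool-isProp c δ f h h′ =
    funext λ k₁ → funext λ k₂ → funext λ _ → ≡ᵇ-irrelevant _ _

  searchᵇ-cong : {K : Set 𝓤} {c : K → K → ℕ∞} {δ : ℕ} (S : UCSearchableWithModulus 𝓥 K c δ)
    {f g : K → Bool} → f ≡ g → (f-cont : ContinuousBool c δ f) (g-cont : ContinuousBool c δ g)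
    → proj₁ (searchᵇ {c = c} {δ} S f f-cont) ≡ proj₁ (searchᵇ {c = c} {δ} S g g-cont)
  searchᵇ-cong {c = c} {δ} S {f} refl f-cont g-cont =
    cong (λ h → proj₁ (searchᵇ {c = c} {δ} S f h)) (ContinuousBool-isProp c δ f f-cont g-cont)

  cΠ-refl : {T : ℕ → Set 𝓤} {c : (n : ℕ) → T n → T n → ℕ∞}
    → (∀ n x → c n x x ≡ ∞) → (α : Π T) → cΠ T c α α ≡ ∞
  cΠ-refl {T = T} {c} c-refl α = ℕ∞-ext _ _ (prodSeq-refl T c c-refl α)

  module _ {T : ℕ → Set 𝓤} {c : (n : ℕ) → T n → T n → ℕ∞} where

    Π-isClosenessSpace : ((n : ℕ) → IsClosenessSpace (T n) (c n))
      → IsClosenessSpace (Π T) (cΠ T c)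
    Π-isClosenessSpace cs =
      ∞⇒≡ , (λ { α .α refl → cΠ-refl (λ n → closeness-reflexive (cs n)) α }) , symmetric , ultra
      where
        ∞⇒≡ : (α β : Π T) → cΠ T c α β ≡ ∞ → α ≡ β
        ∞⇒≡ α β α≈β = funext λ i → proj₁ (cs i) (α i) (β i)
          (ℕ∞-ext _ _ λ k → prodSeq-coordinate T c α β i k (cong (λ u → ι u (i + k)) α≈β))
        symmetric : (α β : Π T) → cΠ T c α β ≡ cΠ T c β α
        symmetric α β =
          ℕ∞-ext _ _ (prodSeq-sym T c (λ n → proj₁ (proj₂ (proj₂ (cs n)))) α β)
        ultra : (α β γ : Π T) → min (cΠ T c α β) (cΠ T c β γ) ≼ cΠ T c α γ
        ultra = cΠ-ultra T c (λ n → proj₂ (proj₂ (proj₂ (cs n))))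

    module Π-search-step (c-refl : ∀ n x → c n x x ≡ ∞) {d : ℕ}
      (search-head : UCSearchable 𝓥 (T 0) (c 0))
      (search-tail : UCSearchableWithModulus 𝓥 (Π (λ n → T (suc n))) (cΠ _ (λ n → c (suc n))) d)
      (p : Π T → Set 𝓥) (p-prop : (α : Π T) → isProp (p α)) (p? : (α : Π T) → Dec (p α))
      (p-cont : UniformlyContinuous (cΠ T c) (suc d) p) where

      cₜ : Π (λ n → T (suc n)) → Π (λ n → T (suc n)) → ℕ∞
      cₜ = cΠ _ (λ n → c (suc n))

      -- Bool-valued, so that logically equivalent tail predicates become equal by funext
      -- and are searched to the same tail (see same-tail below); without propositional
      -- extensionality this fails for 𝓥-valued predicates.
      tail-predicate : T 0 → Π (λ n → T (suc n)) → Bool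
      tail-predicate x β = isYes (p? (x ∷ β))

      tail-predicate-continuous : (x : T 0) → ContinuousBool cₜ d (tail-predicate x)
      tail-predicate-continuous x β β′ β≈β′ =
        isYes-⇔ (mk⇔ (proj₁ x∷β≈) (proj₂ x∷β≈)) (p? (x ∷ β)) (p? (x ∷ β′))
        where
          x∷β≈ : (p (x ∷ β) → p (x ∷ β′)) × (p (x ∷ β′) → p (x ∷ β))
          x∷β≈ = p-cont _ _ (∷-close {d = d} (≡∞⇒≼ (under (suc d)) (c-refl 0 x)) β≈β′)

      best-tail : T 0 → Π (λ n → T (suc n))
      best-tail x =
        proj₁ (searchᵇ {c = cₜ} {d} search-tail (tail-predicate x) (tail-predicate-continuous x))

      head-predicate : T 0 → Set 𝓥
      head-predicate x = p (x ∷ best-tail x)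

      head-predicate-continuous : UniformlyContinuous (c 0) (suc d) head-predicate
      head-predicate-continuous x x′ x≈x′ =
        (λ px → subst (λ β → p (x′ ∷ β)) same-tail (proj₁ (swap-head (best-tail x)) px))
        , (λ px′ → proj₂ (swap-head (best-tail x)) (subst (λ β → p (x′ ∷ β)) (sym same-tail) px′))
        where
          swap-head : ∀ β → (p (x ∷ β) → p (x′ ∷ β)) × (p (x′ ∷ β) → p (x ∷ β))
          swap-head β =
            p-cont _ _ (∷-close {d = d} x≈x′ (≡∞⇒≼ (under d) (cΠ-refl (λ n → c-refl (suc n)) β)))
          same-tail : best-tail x ≡ best-tail x′
          same-tail = searchᵇ-cong {c = cₜ} {d} search-tail
            (funext λ β → isYes-⇔ (mk⇔ (proj₁ (swap-head β)) (proj₂ (swap-head β)))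
                                    (p? (x ∷ β)) (p? (x′ ∷ β)))
            (tail-predicate-continuous x) (tail-predicate-continuous x′)

      found-head : Σ (T 0) (λ x₀ → Σ (T 0) head-predicate → head-predicate x₀)
      found-head = search-head head-predicate (λ x → p-prop _) (λ x → p? _) (suc d)
                     head-predicate-continuous

      witness : Π T
      witness = proj₁ found-head ∷ best-tail (proj₁ found-head)

      witness-correct : Σ (Π T) p → p witness
      witness-correct (α , pα) = proj₂ found-head (α 0 , toWitness best-tail-works)
        where
          best-tail-works : True (p? (α 0 ∷ best-tail (α 0)))
          best-tail-works =
            proj₂ (searchᵇ {c = cₜ} {d} search-tail _ (tail-predicate-continuous (α 0)))
              (tail α , fromWitness (subst p (sym (∷-η α)) pα))

  Π-searchable-with-modulus : (δ : ℕ) (T : ℕ → Set 𝓤) (c : (n : ℕ) → T n → T n → ℕ∞)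
    → (∀ n x → c n x x ≡ ∞) → ((n : ℕ) → UCSearchable 𝓥 (T n) (c n))
    → UCSearchableWithModulus 𝓥 (Π T) (cΠ T c) δ
  Π-searchable-with-modulus zero T c c-refl S p p-prop p? p-cont =
    α₀ , λ (α , pα) → proj₁ (p-cont α α₀ (C-zero (cΠ T c) α α₀)) pα
    where
      α₀ : Π T
      α₀ n = UCSearchable⇒inhabited {c = c n} (S n)
  Π-searchable-with-modulus (suc d) T c c-refl S p p-prop p? p-cont =
    witness , witness-correct
    where
      open Π-search-step c-refl {d} (S 0)
        (Π-searchable-with-modulus d _ (λ n → c (suc n)) (λ n → c-refl (suc n)) (λ n → S (suc n)))
        p p-prop p? p-cont

theorem3p96 : (funext : ∀ {a b} → Extensionality a b)
    → {𝓤 𝓥 : Level} (T : ℕ → Set 𝓤) (c : (n : ℕ) → T n → T n → ℕ∞)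
    → ((n : ℕ) → IsClosenessSpace (T n) (c n))
    → ((n : ℕ) → UCSearchable 𝓥 (T n) (c n))
    → IsClosenessSpace (Π T) (cΠ T c) × UCSearchable 𝓥 (Π T) (cΠ T c)
theorem3p96 funext T c cs S =
  Π-isClosenessSpace funext cs ,
  λ p p-prop p? δ →
    Π-searchable-with-modulus funext δ T c (λ n → closeness-reflexive (cs n)) S p p-prop p?
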